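{- Consider the following algorithm for the free-block server placement problem described in the context: for each job $j$, create $\lceil d_j/\widehat f_j(\alpha_j)\rceil$ blocks of size $\alpha_j$, all assigned to job $j$; then pack all these blocks (over all jobs) onto machines with capacity $k$ using first-fit (each block is placed on the first machine with enough free processors, opening a new machine if none exists). The resulting feasible solution uses at most $$1+4\cdot\frac{1}{k}\sum_{j=1}^n \alpha_j\cdot \frac{d_j}{\widehat f_j(\alpha_j)}$$ machines.
   Context: Instance: positive integer $k$ (processors per machine) and $n$ jobs; job $j$ has a positive integer demand $d_j$ and a vector $(f_j(1),\dots,f_j(k))$ of integers with $f_j(i)\ge 1$ for all $i$ ($f_j$ need not be monotone), where $f_j(i)$ is the demand satisfied by a block of $i$ processors. A solution uses some number of machines; the $k$ processors of each machine are partitioned into blocks of arbitrary sizes, each block assigned to at most one job; it is feasible if for each job $j$ the sum of $f_j(i)$ over the blocks (of size $i$) assigned to $j$ is at least $d_j$. Define $\widehat f_j(i)=\min\{f_j(i),d_j\}$ and let $\alpha_j$ be the smallest $i\in\{1,\dots,k\}$ maximizing $\widehat f_j(i)/i$. -}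

module Defs where

open import Data.Nat using (ℕ; zero; suc; _+_; _*_; _∸_; _≤_; _<_; _⊓_; _≤ᵇ_)
open import Data.Nat.DivMod using (_/_)
open import Data.Fin using (Fin; zero; suc)
open import Data.Bool using (if_then_else_)
open import Data.List using (List; []; _∷_; _++_; replicate; length)
open import Data.Integer using (+_)
import Data.Rational as ℚ
open ℚ using (ℚ; 0ℚ)

-- Rational a / b for naturals; the (unused) case b = 0 is sent to 0.
_÷_ : ℕ → ℕ → ℚ
a ÷ zero = 0ℚ
a ÷ suc b = ℚ._/_ (+ a) (suc b)

-- ⌈ d / a ⌉ for a ≥ 1 (the unused case a = 0 is sent to 0).
ceilDiv : ℕ → ℕ → ℕ
ceilDiv d zero = 0
ceilDiv d (suc a) = (d + a) / suc a

Σℚ : (n : ℕ) → (Fin n → ℚ) → ℚ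
Σℚ zero g = 0ℚ
Σℚ (suc n) g = g zero ℚ.+ Σℚ n (λ j → g (suc j))

fhat : (d : ℕ) → (f : ℕ → ℕ) → ℕ → ℕ
fhat d f i = f i ⊓ d

-- a is the smallest i ∈ {1..k} maximizing f̂(i)/i  (ratios compared by
-- cross-multiplication, all denominators are positive)
IsAlpha : (k d : ℕ) → (f : ℕ → ℕ) → ℕ → Set
IsAlpha k d f a =
  (1 ≤ a) × (a ≤ k)
  × (∀ i → 1 ≤ i → i ≤ k → fhat d f i * a ≤ fhat d f a * i)
  × (∀ i → 1 ≤ i → i < a → fhat d f i * a < fhat d f a * i)
  where open import Data.Product using (_×_)

-- A machine is represented by its number of occupied processors;
-- the list of machines is in opening order.
ffInsert : (k s : ℕ) → List ℕ → List ℕ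
ffInsert k s [] = s ∷ []
ffInsert k s (l ∷ ls) = if (l + s) ≤ᵇ k then (l + s) ∷ ls else l ∷ ffInsert k s ls

firstFit : (k : ℕ) → List ℕ → List ℕ
firstFit k = go []
  where
  go : List ℕ → List ℕ → List ℕ
  go ms [] = ms
  go ms (s ∷ ss) = go (ffInsert k s ms) ss

algBlocks : (n : ℕ) → (d : Fin n → ℕ) → (f : Fin n → ℕ → ℕ) → (α : Fin n → ℕ) → List ℕ
algBlocks zero d f α = []
algBlocks (suc n) d f α =
  replicate (ceilDiv (d zero) (fhat (d zero) (f zero) (α zero))) (α zero)
  ++ algBlocks n (λ j → d (suc j)) (λ j → f (suc j)) (λ j → α (suc j))

algMachines : (k n : ℕ) → (d : Fin n → ℕ) → (f : Fin n → ℕ → ℕ) → (α : Fin n → ℕ) → ℕ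
algMachines k n d f α = length (firstFit k (algBlocks n d f α))

-- First fit leaves no two consecutive machines with total load at most k (otherwise the
-- later block would have fitted on the earlier machine), so the number m of machines
-- satisfies m k ≤ k + 2 V, where V is the total size of the blocks. Job j contributes
-- ⌈d/f̂⌉ α ≤ (d + f̂ - 1) α / f̂ ≤ 2 α d / f̂ to V, because f̂ = min (f (α), d) ≤ d.
{-# OPTIONS --safe #-}
module Submission where

open import Defs
open import Data.Nat using (ℕ; _≤_; _*_)
open import Data.Fin using (Fin)
open import Data.Product using (_×_; _,_)
open import Data.Integer using (+_)
import Data.Rational as ℚ

open import Data.Bool using (true; false; T)
open import Data.Fin using (zero; suc)
open import Data.List using (List; []; _∷_; _++_; replicate; length)
open import Data.List.Relation.Unary.Linked using (Linked; []; [-]; _∷_)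
open import Data.Nat using (zero; suc; _+_; _<_; _≤ᵇ_; z≤n; s≤s⁻¹)
open import Data.Nat.DivMod using (_%_; m≡m%n+[m/n]*n; m/n*n≤m; m%n<n)
open import Data.Nat.ListAction using (sum)
open import Data.Nat.ListAction.Properties using (sum-++)
open import Data.Nat.Properties
open import Data.Nat.Tactic.RingSolver using (solve-∀)
open import Function using (_∋_)
import Data.Integer as ℤ using (_+_; _*_; _≤_; +≤+)
import Data.Integer.Properties as ℤ
open ℚ using (ℚ)
import Data.Rational.Properties as ℚₚ
open import Data.Rational.Unnormalised using (mkℚᵘ; *≡*; *≤*)
  renaming (_+_ to _+ᵘ_; _*_ to _*ᵘ_; _≤_ to _≤ᵘ_)
import Data.Rational.Unnormalised.Properties as ℚᵘₚ
open import Data.Rational.Solver using (module +-*-Solver)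
open import Relation.Binary.PropositionalEquality

Overfull : ℕ → ℕ → ℕ → Set
Overfull k a b = k < a + b

-- `firstFit` runs an accumulator function that is local to its definition. Abstracting the
-- initial empty list turns the goal below into a pattern-unification problem whose unique
-- solution is that local function, so `firstFitFrom` computes exactly like it.
mutual
  firstFitFrom : ℕ → List ℕ → List ℕ → List ℕ
  firstFitFrom = _

  firstFit≡firstFitFrom[] : ∀ k bs → firstFit k bs ≡ firstFitFrom k [] bs
  firstFit≡firstFitFrom[] k bs with List ℕ ∋ []
  ... | ms = refl

≤ᵇ≡false⇒> : ∀ {m n} → (m ≤ᵇ n) ≡ false → n < m
≤ᵇ≡false⇒> {m} {n} m≰ᵇn = ≰⇒> (λ m≤n → subst T m≰ᵇn (≤⇒≤ᵇ m≤n))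

sum-ffInsert : ∀ k s ms → sum (ffInsert k s ms) ≡ s + sum ms
sum-ffInsert k s [] = refl
sum-ffInsert k s (l ∷ ms) with (l + s) ≤ᵇ k
... | true  = trans (cong (_+ sum ms) (+-comm l s)) (+-assoc s l (sum ms))
... | false = trans (cong (λ v → l + v) (sum-ffInsert k s ms)) (x+[y+z]≡y+[x+z] l s (sum ms))
  where
  x+[y+z]≡y+[x+z] : ∀ x y z → x + (y + z) ≡ y + (x + z)
  x+[y+z]≡y+[x+z] = solve-∀

sum-firstFitFrom : ∀ k ms bs → sum (firstFitFrom k ms bs) ≡ sum ms + sum bs
sum-firstFitFrom k ms [] = sym (+-identityʳ (sum ms))
sum-firstFitFrom k ms (b ∷ bs) = begin
  sum (firstFitFrom k (ffInsert k b ms) bs) ≡⟨ sum-firstFitFrom k (ffInsert k b ms) bs ⟩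
  sum (ffInsert k b ms) + sum bs            ≡⟨ cong (_+ sum bs) (sum-ffInsert k b ms) ⟩
  (b + sum ms) + sum bs                     ≡⟨ cong (_+ sum bs) (+-comm b (sum ms)) ⟩
  (sum ms + b) + sum bs                     ≡⟨ +-assoc (sum ms) b (sum bs) ⟩
  sum ms + (b + sum bs)                     ∎
  where open ≡-Reasoning

overfull-grow : ∀ {k a b ms} → a ≤ b → Linked (Overfull k) (a ∷ ms) → Linked (Overfull k) (b ∷ ms)
overfull-grow a≤b [-] = [-]
overfull-grow {ms = l ∷ _} a≤b (k<a+l ∷ rest) = <-≤-trans k<a+l (+-monoˡ-≤ l a≤b) ∷ rest

ffInsert-overfull-after : ∀ {k a} s ms → k < a + s →
  Linked (Overfull k) (a ∷ ms) → Linked (Overfull k) (a ∷ ffInsert k s ms)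
ffInsert-overfull-after s [] k<a+s [-] = k<a+s ∷ [-]
ffInsert-overfull-after {k} {a} s (l ∷ ms) k<a+s (k<a+l ∷ rest) with (l + s) ≤ᵇ k in fits
... | true  = <-≤-trans k<a+l (+-monoʳ-≤ a (m≤m+n l s)) ∷ overfull-grow (m≤m+n l s) rest
... | false = k<a+l ∷ ffInsert-overfull-after s ms (≤ᵇ≡false⇒> fits) rest

ffInsert-overfull : ∀ {k} s ms → Linked (Overfull k) ms → Linked (Overfull k) (ffInsert k s ms)
ffInsert-overfull s [] [] = [-]
ffInsert-overfull {k} s (l ∷ ms) overfull with (l + s) ≤ᵇ k in fits
... | true  = overfull-grow (m≤m+n l s) overfull
... | false = ffInsert-overfull-after s ms (≤ᵇ≡false⇒> fits) overfull

firstFitFrom-overfull : ∀ {k} ms bs → Linked (Overfull k) ms → Linked (Overfull k) (firstFitFrom k ms bs)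
firstFitFrom-overfull ms [] overfull = overfull
firstFitFrom-overfull ms (b ∷ bs) overfull =
  firstFitFrom-overfull (ffInsert _ b ms) bs (ffInsert-overfull b ms overfull)

overfull-tail-length : ∀ {k} a ms → Linked (Overfull k) (a ∷ ms) → length ms * k ≤ a + 2 * sum ms
overfull-tail-length a [] [-] = z≤n
overfull-tail-length {k} a (l ∷ ms) (k<a+l ∷ rest) = begin
  k + length ms * k           ≤⟨ +-mono-≤ (<⇒≤ k<a+l) (overfull-tail-length l ms rest) ⟩
  (a + l) + (l + 2 * sum ms)  ≡⟨ regroup a l (sum ms) ⟩
  a + 2 * (l + sum ms)        ∎
  where
  open ≤-Reasoning
  regroup : ∀ a l s → (a + l) + (l + 2 * s) ≡ a + 2 * (l + s)
  regroup = solve-∀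

overfull-length : ∀ {k} ms → Linked (Overfull k) ms → length ms * k ≤ k + 2 * sum ms
overfull-length [] [] = z≤n
overfull-length {k} (l ∷ ms) overfull = begin
  k + length ms * k       ≤⟨ +-monoʳ-≤ k (overfull-tail-length l ms overfull) ⟩
  k + (l + 2 * sum ms)    ≤⟨ +-monoʳ-≤ k (+-monoˡ-≤ (2 * sum ms) (m≤n*m l 2)) ⟩
  k + (2 * l + 2 * sum ms) ≡⟨ cong (λ v → k + v) (*-distribˡ-+ 2 l (sum ms)) ⟨
  k + 2 * (l + sum ms)    ∎
  where open ≤-Reasoning

firstFit-length : ∀ k bs → length (firstFit k bs) * k ≤ k + 2 * sum bs
firstFit-length k bs rewrite firstFit≡firstFitFrom[] k bs =
  subst (λ v → length (firstFitFrom k [] bs) * k ≤ k + 2 * v)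
        (sum-firstFitFrom k [] bs)
        (overfull-length _ (firstFitFrom-overfull [] bs []))

m≤ceilDiv[m,1+n]*[1+n] : ∀ m n → m ≤ ceilDiv m (suc n) * suc n
m≤ceilDiv[m,1+n]*[1+n] m n = +-cancelˡ-≤ n m _ (begin
  n + m                                     ≡⟨ +-comm n m ⟩
  m + n                                     ≡⟨ m≡m%n+[m/n]*n (m + n) (suc n) ⟩
  (m + n) % suc n + ceilDiv m (suc n) * suc n ≤⟨ +-monoˡ-≤ _ (s≤s⁻¹ (m%n<n (m + n) (suc n))) ⟩
  n + ceilDiv m (suc n) * suc n             ∎)
  where open ≤-Reasoning

ceilDiv[m,1+n]*[1+n]≤m+n : ∀ m n → ceilDiv m (suc n) * suc n ≤ m + n
ceilDiv[m,1+n]*[1+n]≤m+n m n = m/n*n≤m (m + n) (suc n)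

m≤ceilDiv[m,n]*o : ∀ m {n o} → 1 ≤ n → n ≤ o → m ≤ ceilDiv m n * o
m≤ceilDiv[m,n]*o m {suc n} _ 1+n≤o =
  ≤-trans (m≤ceilDiv[m,1+n]*[1+n] m n) (*-monoʳ-≤ (ceilDiv m (suc n)) 1+n≤o)

ceilDiv[m,n]*n≤2*m : ∀ m {n} → 1 ≤ n → n ≤ m → ceilDiv m n * n ≤ 2 * m
ceilDiv[m,n]*n≤2*m m {suc n} _ 1+n≤m = begin
  ceilDiv m (suc n) * suc n ≤⟨ ceilDiv[m,1+n]*[1+n]≤m+n m n ⟩
  m + n                     ≤⟨ +-monoʳ-≤ m (≤-trans (n≤1+n n) 1+n≤m) ⟩
  m + m                     ≡⟨ cong (λ v → m + v) (+-identityʳ m) ⟨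
  2 * m                     ∎
  where open ≤-Reasoning

ceilDiv[m,n]*o*n≤2*[o*m] : ∀ m o {n} → 1 ≤ n → n ≤ m → ceilDiv m n * o * n ≤ 2 * (o * m)
ceilDiv[m,n]*o*n≤2*[o*m] m o {n} 1≤n n≤m = begin
  ceilDiv m n * o * n   ≡⟨ x*y*z≡y*[x*z] (ceilDiv m n) o n ⟩
  o * (ceilDiv m n * n) ≤⟨ *-monoʳ-≤ o (ceilDiv[m,n]*n≤2*m m 1≤n n≤m) ⟩
  o * (2 * m)           ≡⟨ x*[2*y]≡2*[x*y] o m ⟩
  2 * (o * m)           ∎
  where
  open ≤-Reasoning
  x*y*z≡y*[x*z] : ∀ x y z → x * y * z ≡ y * (x * z)
  x*y*z≡y*[x*z] = solve-∀
  x*[2*y]≡2*[x*y] : ∀ x y → x * (2 * y) ≡ 2 * (x * y)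
  x*[2*y]≡2*[x*y] = solve-∀

fromℚᵘ-homo-+ : ∀ p q → ℚ.fromℚᵘ (p +ᵘ q) ≡ ℚ.fromℚᵘ p ℚ.+ ℚ.fromℚᵘ q
fromℚᵘ-homo-+ p q = ℚₚ.toℚᵘ-injective (begin
  ℚ.toℚᵘ (ℚ.fromℚᵘ (p +ᵘ q))                   ≈⟨ ℚₚ.toℚᵘ-fromℚᵘ (p +ᵘ q) ⟩
  p +ᵘ q                                       ≈⟨ ℚᵘₚ.+-cong (ℚₚ.toℚᵘ-fromℚᵘ p) (ℚₚ.toℚᵘ-fromℚᵘ q) ⟨
  ℚ.toℚᵘ (ℚ.fromℚᵘ p) +ᵘ ℚ.toℚᵘ (ℚ.fromℚᵘ q)   ≈⟨ ℚₚ.toℚᵘ-homo-+ (ℚ.fromℚᵘ p) (ℚ.fromℚᵘ q) ⟨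
  ℚ.toℚᵘ (ℚ.fromℚᵘ p ℚ.+ ℚ.fromℚᵘ q)           ∎)
  where open ℚᵘₚ.≃-Reasoning

fromℚᵘ-homo-* : ∀ p q → ℚ.fromℚᵘ (p *ᵘ q) ≡ ℚ.fromℚᵘ p ℚ.* ℚ.fromℚᵘ q
fromℚᵘ-homo-* p q = ℚₚ.toℚᵘ-injective (begin
  ℚ.toℚᵘ (ℚ.fromℚᵘ (p *ᵘ q))                   ≈⟨ ℚₚ.toℚᵘ-fromℚᵘ (p *ᵘ q) ⟩
  p *ᵘ q                                       ≈⟨ ℚᵘₚ.*-cong (ℚₚ.toℚᵘ-fromℚᵘ p) (ℚₚ.toℚᵘ-fromℚᵘ q) ⟨
  ℚ.toℚᵘ (ℚ.fromℚᵘ p) *ᵘ ℚ.toℚᵘ (ℚ.fromℚᵘ q)   ≈⟨ ℚₚ.toℚᵘ-homo-* (ℚ.fromℚᵘ p) (ℚ.fromℚᵘ q) ⟨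
  ℚ.toℚᵘ (ℚ.fromℚᵘ p ℚ.* ℚ.fromℚᵘ q)           ∎)
  where open ℚᵘₚ.≃-Reasoning

fromℚᵘ-mono-≤ : ∀ {p q} → p ≤ᵘ q → ℚ.fromℚᵘ p ℚ.≤ ℚ.fromℚᵘ q
fromℚᵘ-mono-≤ {p} {q} p≤q = ℚₚ.toℚᵘ-cancel-≤
  (ℚᵘₚ.≤-respˡ-≃ (ℚᵘₚ.≃-sym (ℚₚ.toℚᵘ-fromℚᵘ p)) (ℚᵘₚ.≤-respʳ-≃ (ℚᵘₚ.≃-sym (ℚₚ.toℚᵘ-fromℚᵘ q)) p≤q))

-- `m ÷ suc n` is `fromℚᵘ (mkℚᵘ (+ m) n)` by definition, so identities between such fractions
-- reduce to cross-multiplication in ℚᵘ.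
fromℕ : ℕ → ℚ
fromℕ n = n ÷ 1

fromℕ-+ : ∀ m n → fromℕ (m + n) ≡ fromℕ m ℚ.+ fromℕ n
fromℕ-+ m n = trans
  (ℚₚ.fromℚᵘ-cong {mkℚᵘ (+ (m + n)) 0} {mkℚᵘ (+ m) 0 +ᵘ mkℚᵘ (+ n) 0} (*≡* (cong (ℤ._* + 1)
    (trans (ℤ.pos-+ m n) (sym (cong₂ ℤ._+_ (ℤ.*-identityʳ (+ m)) (ℤ.*-identityʳ (+ n))))))))
  (fromℚᵘ-homo-+ (mkℚᵘ (+ m) 0) (mkℚᵘ (+ n) 0))

fromℕ-* : ∀ m n → fromℕ (m * n) ≡ fromℕ m ℚ.* fromℕ n
fromℕ-* m n = trans
  (ℚₚ.fromℚᵘ-cong {mkℚᵘ (+ (m * n)) 0} {mkℚᵘ (+ m) 0 *ᵘ mkℚᵘ (+ n) 0} (*≡* (cong (ℤ._* + 1) (ℤ.pos-* m n))))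
  (fromℚᵘ-homo-* (mkℚᵘ (+ m) 0) (mkℚᵘ (+ n) 0))

fromℕ-mono-≤ : ∀ {m n} → m ≤ n → fromℕ m ℚ.≤ fromℕ n
fromℕ-mono-≤ {m} {n} m≤n = fromℚᵘ-mono-≤ {mkℚᵘ (+ m) 0} {mkℚᵘ (+ n) 0}
  (*≤* (subst₂ ℤ._≤_ (sym (ℤ.*-identityʳ (+ m))) (sym (ℤ.*-identityʳ (+ n))) (ℤ.+≤+ m≤n)))

÷≡fromℕ*1÷ : ∀ m n → m ÷ suc n ≡ fromℕ m ℚ.* (1 ÷ suc n)
÷≡fromℕ*1÷ m n = trans
  (ℚₚ.fromℚᵘ-cong {mkℚᵘ (+ m) n} {mkℚᵘ (+ m) 0 *ᵘ mkℚᵘ (+ 1) n}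
    (*≡* (cong₂ ℤ._*_ (sym (ℤ.*-identityʳ (+ m))) (cong (λ x → + suc x) (+-identityʳ n)))))
  (fromℚᵘ-homo-* (mkℚᵘ (+ m) 0) (mkℚᵘ (+ 1) n))

fromℕ*1÷≡1 : ∀ n → fromℕ (suc n) ℚ.* (1 ÷ suc n) ≡ ℚ.1ℚ
fromℕ*1÷≡1 n = trans (sym (÷≡fromℕ*1÷ (suc n) n))
  (ℚₚ.fromℚᵘ-cong {mkℚᵘ (+ suc n) n} {mkℚᵘ (+ 1) 0} (*≡* (ℤ.*-comm (+ suc n) (+ 1))))

1÷-nonNeg : ∀ n → ℚ.NonNegative (1 ÷ suc n)
1÷-nonNeg n = ℚₚ.normalize-nonNeg 1 (suc n)

fromℕ≤fromℕ*1÷ : ∀ m {p} n → m * suc n ≤ p → fromℕ m ℚ.≤ fromℕ p ℚ.* (1 ÷ suc n)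
fromℕ≤fromℕ*1÷ m {p} n m*[1+n]≤p = begin
  fromℕ m                                 ≡⟨ ℚₚ.*-identityʳ (fromℕ m) ⟨
  fromℕ m ℚ.* ℚ.1ℚ                        ≡⟨ cong (fromℕ m ℚ.*_) (fromℕ*1÷≡1 n) ⟨
  fromℕ m ℚ.* (fromℕ (suc n) ℚ.* c)       ≡⟨ ℚₚ.*-assoc (fromℕ m) (fromℕ (suc n)) c ⟨
  (fromℕ m ℚ.* fromℕ (suc n)) ℚ.* c       ≡⟨ cong (ℚ._* c) (fromℕ-* m (suc n)) ⟨
  fromℕ (m * suc n) ℚ.* c                 ≤⟨ ℚₚ.*-monoʳ-≤-nonNeg c {{1÷-nonNeg n}} (fromℕ-mono-≤ m*[1+n]≤p) ⟩
  fromℕ p ℚ.* c                           ∎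
  where
  open ℚₚ.≤-Reasoning
  c : ℚ
  c = 1 ÷ suc n

Σℚ-mono-≤ : ∀ n {g h : Fin n → ℚ} → (∀ j → g j ℚ.≤ h j) → Σℚ n g ℚ.≤ Σℚ n h
Σℚ-mono-≤ zero    g≤h = ℚₚ.≤-refl
Σℚ-mono-≤ (suc n) g≤h = ℚₚ.+-mono-≤ (g≤h zero) (Σℚ-mono-≤ n (λ j → g≤h (suc j)))

*-distribˡ-Σℚ : ∀ c n (g : Fin n → ℚ) → c ℚ.* Σℚ n g ≡ Σℚ n (λ j → c ℚ.* g j)
*-distribˡ-Σℚ c zero    g = ℚₚ.*-zeroʳ c
*-distribˡ-Σℚ c (suc n) g = trans (ℚₚ.*-distribˡ-+ c (g zero) (Σℚ n (λ j → g (suc j))))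
  (cong (c ℚ.* g zero ℚ.+_) (*-distribˡ-Σℚ c n (λ j → g (suc j))))

sum-replicate : ∀ c a → sum (replicate c a) ≡ c * a
sum-replicate zero    a = refl
sum-replicate (suc c) a = cong (λ v → a + v) (sum-replicate c a)

fromℕ-sum-algBlocks : ∀ n d f α → fromℕ (sum (algBlocks n d f α))
  ≡ Σℚ n (λ j → fromℕ (ceilDiv (d j) (fhat (d j) (f j) (α j)) * α j))
fromℕ-sum-algBlocks zero    d f α = refl
fromℕ-sum-algBlocks (suc n) d f α = begin
  fromℕ (sum (replicate c (α zero) ++ rest))   ≡⟨ cong fromℕ (sum-++ (replicate c (α zero)) rest) ⟩
  fromℕ (sum (replicate c (α zero)) + sum rest) ≡⟨ cong (λ v → fromℕ (v + sum rest)) (sum-replicate c (α zero)) ⟩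
  fromℕ (c * α zero + sum rest)                ≡⟨ fromℕ-+ (c * α zero) (sum rest) ⟩
  fromℕ (c * α zero) ℚ.+ fromℕ (sum rest)       ≡⟨ cong (fromℕ (c * α zero) ℚ.+_)
                                                   (fromℕ-sum-algBlocks n (λ j → d (suc j)) (λ j → f (suc j)) (λ j → α (suc j))) ⟩
  Σℚ (suc n) (λ j → fromℕ (ceilDiv (d j) (fhat (d j) (f j) (α j)) * α j)) ∎
  where
  open ≡-Reasoning
  c : ℕ
  c = ceilDiv (d zero) (fhat (d zero) (f zero) (α zero))
  rest : List ℕ
  rest = algBlocks n (λ j → d (suc j)) (λ j → f (suc j)) (λ j → α (suc j))

jobVolume≤ : ∀ a d {h} → 1 ≤ h → h ≤ d → fromℕ (ceilDiv d h * a) ℚ.≤ fromℕ 2 ℚ.* ((a * d) ÷ h)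
jobVolume≤ a d {suc h} 1≤h h≤d = begin
  fromℕ (c * a)                                    ≤⟨ fromℕ≤fromℕ*1÷ (c * a) h (ceilDiv[m,n]*o*n≤2*[o*m] d a 1≤h h≤d) ⟩
  fromℕ (2 * (a * d)) ℚ.* r                        ≡⟨ cong (ℚ._* r) (fromℕ-* 2 (a * d)) ⟩
  (fromℕ 2 ℚ.* fromℕ (a * d)) ℚ.* r                ≡⟨ ℚₚ.*-assoc (fromℕ 2) (fromℕ (a * d)) r ⟩
  fromℕ 2 ℚ.* (fromℕ (a * d) ℚ.* r)                ≡⟨ cong (fromℕ 2 ℚ.*_) (÷≡fromℕ*1÷ (a * d) h) ⟨
  fromℕ 2 ℚ.* ((a * d) ÷ suc h)                    ∎
  where
  open ℚₚ.≤-Reasoning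
  c : ℕ
  c = ceilDiv d (suc h)
  r : ℚ
  r = 1 ÷ suc h

fromℕ≤1+2*1÷*fromℕ : ∀ k m v → m * suc k ≤ suc k + 2 * v →
  fromℕ m ℚ.≤ ℚ.1ℚ ℚ.+ fromℕ 2 ℚ.* (1 ÷ suc k) ℚ.* fromℕ v
fromℕ≤1+2*1÷*fromℕ k m v m*[1+k]≤1+k+2v = begin
  fromℕ m                                             ≤⟨ fromℕ≤fromℕ*1÷ m k m*[1+k]≤1+k+2v ⟩
  fromℕ (suc k + 2 * v) ℚ.* c                         ≡⟨ cong (ℚ._* c) (fromℕ-+ (suc k) (2 * v)) ⟩
  (fromℕ (suc k) ℚ.+ fromℕ (2 * v)) ℚ.* c             ≡⟨ ℚₚ.*-distribʳ-+ c (fromℕ (suc k)) (fromℕ (2 * v)) ⟩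
  fromℕ (suc k) ℚ.* c ℚ.+ fromℕ (2 * v) ℚ.* c         ≡⟨ cong₂ ℚ._+_ (fromℕ*1÷≡1 k) (cong (ℚ._* c) (fromℕ-* 2 v)) ⟩
  ℚ.1ℚ ℚ.+ fromℕ 2 ℚ.* fromℕ v ℚ.* c                  ≡⟨ cong (ℚ.1ℚ ℚ.+_) (x*y*z≡x*z*y (fromℕ 2) (fromℕ v) c) ⟩
  ℚ.1ℚ ℚ.+ fromℕ 2 ℚ.* c ℚ.* fromℕ v                  ∎
  where
  open ℚₚ.≤-Reasoning
  open +-*-Solver
  c : ℚ
  c = 1 ÷ suc k
  x*y*z≡x*z*y : ∀ x y z → x ℚ.* y ℚ.* z ≡ x ℚ.* z ℚ.* y
  x*y*z≡x*z*y = solve 3 (λ x y z → x :* y :* z := x :* z :* y) refl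

algBlocks-volume≤ : ∀ n d f α → (∀ j → 1 ≤ fhat (d j) (f j) (α j)) →
  fromℕ (sum (algBlocks n d f α)) ℚ.≤ fromℕ 2 ℚ.* Σℚ n (λ j → (α j * d j) ÷ fhat (d j) (f j) (α j))
algBlocks-volume≤ n d f α 1≤h = begin
  fromℕ (sum (algBlocks n d f α))                  ≡⟨ fromℕ-sum-algBlocks n d f α ⟩
  Σℚ n (λ j → fromℕ (ceilDiv (d j) (h j) * α j))   ≤⟨ Σℚ-mono-≤ n (λ j → jobVolume≤ (α j) (d j) (1≤h j) (m⊓n≤n _ _)) ⟩
  Σℚ n (λ j → fromℕ 2 ℚ.* ((α j * d j) ÷ h j))     ≡⟨ *-distribˡ-Σℚ (fromℕ 2) n _ ⟨
  fromℕ 2 ℚ.* Σℚ n (λ j → (α j * d j) ÷ h j)       ∎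
  where
  open ℚₚ.≤-Reasoning
  h : Fin n → ℕ
  h j = fhat (d j) (f j) (α j)

firstFit-machines≤ : ∀ k bs R → fromℕ (sum bs) ℚ.≤ fromℕ 2 ℚ.* R →
  fromℕ (length (firstFit (suc k) bs)) ℚ.≤ ℚ.1ℚ ℚ.+ fromℕ 4 ℚ.* (1 ÷ suc k) ℚ.* R
firstFit-machines≤ k bs R volume≤2*R = begin
  fromℕ m                                   ≤⟨ fromℕ≤1+2*1÷*fromℕ k m (sum bs) (firstFit-length (suc k) bs) ⟩
  ℚ.1ℚ ℚ.+ two*c ℚ.* fromℕ (sum bs)          ≤⟨ ℚₚ.+-monoʳ-≤ ℚ.1ℚ (ℚₚ.*-monoˡ-≤-nonNeg two*c {{two*c-nonNeg}} volume≤2*R) ⟩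
  ℚ.1ℚ ℚ.+ two*c ℚ.* (fromℕ 2 ℚ.* R)         ≡⟨ cong (ℚ.1ℚ ℚ.+_) (x*y*[x*z]≡x*x*y*z (fromℕ 2) c R) ⟩
  ℚ.1ℚ ℚ.+ fromℕ 4 ℚ.* c ℚ.* R               ∎
  where
  open ℚₚ.≤-Reasoning
  open +-*-Solver
  m : ℕ
  m = length (firstFit (suc k) bs)
  c : ℚ
  c = 1 ÷ suc k
  two*c : ℚ
  two*c = fromℕ 2 ℚ.* c
  two*c-nonNeg : ℚ.NonNegative two*c
  two*c-nonNeg = ℚₚ.nonNeg*nonNeg⇒nonNeg (fromℕ 2) c {{1÷-nonNeg k}}
  x*y*[x*z]≡x*x*y*z : ∀ x y z → x ℚ.* y ℚ.* (x ℚ.* z) ≡ x ℚ.* x ℚ.* y ℚ.* z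
  x*y*[x*z]≡x*x*y*z = solve 3 (λ x y z → x :* y :* (x :* z) := x :* x :* y :* z) refl

mainTheorem7 : (k n : ℕ) → 1 ≤ k
    → (d : Fin n → ℕ) → (f : Fin n → ℕ → ℕ)
    → (∀ j → 1 ≤ d j)
    → (∀ j i → 1 ≤ i → i ≤ k → 1 ≤ f j i)
    → (α : Fin n → ℕ) → (∀ j → IsAlpha k (d j) (f j) (α j))
    → ((∀ j → d j ≤ ceilDiv (d j) (fhat (d j) (f j) (α j)) * f j (α j))
      × ((+ algMachines k n d f α) ℚ./ 1)
          ℚ.≤ (ℚ.1ℚ ℚ.+ ((+ 4) ℚ./ 1) ℚ.* (1 ÷ k)
                 ℚ.* Σℚ n (λ j → (α j * d j) ÷ fhat (d j) (f j) (α j))))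
mainTheorem7 zero    n () d f 1≤d 1≤f α isAlpha
mainTheorem7 (suc k) n _  d f 1≤d 1≤f α isAlpha =
  demandMet , firstFit-machines≤ k (algBlocks n d f α) _ (algBlocks-volume≤ n d f α 1≤h)
  where
  1≤f[α] : ∀ j → 1 ≤ f j (α j)
  1≤f[α] j = let (1≤α , α≤k , _) = isAlpha j in 1≤f j (α j) 1≤α α≤k

  1≤h : ∀ j → 1 ≤ fhat (d j) (f j) (α j)
  1≤h j = ⊓-glb (1≤f[α] j) (1≤d j)

  demandMet : ∀ j → d j ≤ ceilDiv (d j) (fhat (d j) (f j) (α j)) * f j (α j)
  demandMet j = m≤ceilDiv[m,n]*o (d j) (1≤h j) (m⊓n≤m _ _)
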